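{- Let $f\colon\mathbb Z^2\to\mathbb Z$ be a Riemann function that is slowly growing, i.e., for $i=1,2$ and all $\mathbf d\in\mathbb Z^2$, $f(\mathbf d)\le f(\mathbf d+\mathbf e_i)\le f(\mathbf d)+1$. Let $W=\mathfrak m f$. Then $W$ takes only the values $0$ and $\pm1$. Furthermore, for any $\mathbf d\in\mathbb Z^2$, with $a=f(\mathbf d)$, $$W(\mathbf d)=1\iff f(\mathbf d-\mathbf e_1)=f(\mathbf d-\mathbf e_2)=f(\mathbf d-\mathbf e_1-\mathbf e_2)=a-1,$$ and $$W(\mathbf d)=-1\iff f(\mathbf d-\mathbf e_1)=f(\mathbf d-\mathbf e_2)=a=f(\mathbf d-\mathbf e_1-\mathbf e_2)+1.$$ Moreover, if $W(\mathbf d)\ge 0$ for all $\mathbf d\in\mathbb Z^2$, then $W$ is a perfect matching.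
   Context: $\mathbf e_1,\mathbf e_2$ are the standard basis vectors of $\mathbb Z^2$ and $\deg(\mathbf d)=d_1+d_2$. A Riemann function is an $f\colon\mathbb Z^2\to\mathbb Z$ such that for some $C,a,b\in\mathbb Z$, $f(\mathbf d)=0$ when $\deg(\mathbf d)\le a$ and $f(\mathbf d)=\deg(\mathbf d)+C$ when $\deg(\mathbf d)\ge b$. $(\mathfrak mf)(\mathbf d)=f(\mathbf d)-f(\mathbf d-\mathbf e_1)-f(\mathbf d-\mathbf e_2)+f(\mathbf d-\mathbf e_1-\mathbf e_2)$. A function $W\colon\mathbb Z^2\to\mathbb Z$ that is initially and eventually zero (vanishing when $\deg(\mathbf d)$ is sufficiently small or sufficiently large) is a perfect matching if there is a bijection $\pi\colon\mathbb Z\to\mathbb Z$ with $W(i,j)=1$ if $j=\pi(i)$ and $W(i,j)=0$ otherwise. -}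

module Defs where

open import Data.Integer using (ℤ; _+_; _-_; _≤_; +_; -_)
open import Data.Product using (_×_; _,_; Σ; ∃; proj₁; proj₂)
open import Relation.Binary.PropositionalEquality using (_≡_; _≢_)
open import Function.Bundles using (Bijection)
open import Function.Definitions using (Bijective)

Pt : Set
Pt = ℤ × ℤ

deg : Pt → ℤ
deg (d₁ , d₂) = d₁ + d₂

_-e₁ : Pt → Pt
(d₁ , d₂) -e₁ = (d₁ - + 1 , d₂)

_-e₂ : Pt → Pt
(d₁ , d₂) -e₂ = (d₁ , d₂ - + 1)

_+e₁ : Pt → Pt
(d₁ , d₂) +e₁ = (d₁ + + 1 , d₂)

_+e₂ : Pt → Pt
(d₁ , d₂) +e₂ = (d₁ , d₂ + + 1)

IsRiemann : (Pt → ℤ) → Set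
IsRiemann f = Σ ℤ λ C → Σ ℤ λ a → Σ ℤ λ b →
  ((d : Pt) → deg d ≤ a → f d ≡ + 0) ×
  ((d : Pt) → b ≤ deg d → f d ≡ deg d + C)

SlowlyGrowing : (Pt → ℤ) → Set
SlowlyGrowing f = (d : Pt) →
  (f d ≤ f (d +e₁) × f (d +e₁) ≤ f d + + 1) ×
  (f d ≤ f (d +e₂) × f (d +e₂) ≤ f d + + 1)

𝔪 : (Pt → ℤ) → Pt → ℤ
𝔪 f d = f d - f (d -e₁) - f (d -e₂) + f ((d -e₁) -e₂)

InitiallyEventuallyZero : (Pt → ℤ) → Set
InitiallyEventuallyZero W = Σ ℤ λ a → Σ ℤ λ b →
  ((d : Pt) → deg d ≤ a → W d ≡ + 0) ×
  ((d : Pt) → b ≤ deg d → W d ≡ + 0)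

IsPerfectMatching : (Pt → ℤ) → Set
IsPerfectMatching W = InitiallyEventuallyZero W ×
  Σ (ℤ → ℤ) λ π → Bijective _≡_ _≡_ π ×
    ((i j : ℤ) → (j ≡ π i → W (i , j) ≡ + 1) × (j ≢ π i → W (i , j) ≡ + 0))

-- The four increments of f along the edges of a unit square lie in {0, 1}, and the two
-- ways around the square give the same total.  𝔪 f is the difference of two parallel
-- increments, so it lies in {-1, 0, 1}, and a finite case check identifies when it is ±1.
-- If 𝔪 f ≥ 0, then along each row the horizontal increment is a nondecreasing {0,1}-valued
-- function which is 0 far to the left and 1 far to the right (by the Riemann condition),
-- so it has exactly one jump; that jump is the unique point of the row where 𝔪 f = 1.
-- Doing the same for columns yields an inverse of the resulting map ℤ → ℤ.
module Submission where

open import Defs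
open import Data.Integer using (ℤ; _+_; _-_; _≤_; _<_; +_; -_; -[1+_]; ∣_∣; +≤+; -≤+)
open import Data.Integer.Properties
  using (≤-refl; ≤-trans; ≤-reflexive; <-cmp; +-assoc; +-identityʳ; +-monoʳ-≤; +-monoˡ-≤;
         +-minus-telescope; i-j≤i; i≡j⇒i-j≡0; i-j≡0⇒i≡j; i≤j⇒0≤j-i; 0≤i-j⇒j≤i;
         0≤i⇒+∣i∣≡i; i<j⇒i≤pred[j])
open import Data.Integer.Tactic.RingSolver using (solve-∀)
open import Data.Nat using (zero; suc; s≤s)
open import Data.Product using (_×_; _,_; Σ; proj₁; proj₂)
open import Data.Product.Function.NonDependent.Propositional using (_×-⇔_)
open import Data.Sum using (_⊎_; inj₁; inj₂)
open import Data.Empty using (⊥; ⊥-elim)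
open import Function.Bundles using (_⇔_; mk⇔; Equivalence)
open import Function.Definitions using (Bijective; Inverseˡ; Inverseʳ)
open import Function.Consequences.Propositional using (inverseᵇ⇒bijective)
open import Function.Properties.Equivalence using () renaming (trans to ⇔-trans; sym to ⇔-sym)
open import Relation.Binary.Definitions using (tri<; tri≈; tri>)
open import Relation.Binary.PropositionalEquality
  using (_≡_; _≢_; refl; sym; trans; cong; cong₂; subst; subst₂; module ≡-Reasoning)

open Equivalence using (to; from)

a-[a-c]≡c : ∀ a c → a - (a - c) ≡ c
a-[a-c]≡c = solve-∀

[a+c]-a≡c : ∀ a c → (a + c) - a ≡ c
[a+c]-a≡c = solve-∀

a+[c-a]≡c : ∀ a c → a + (c - a) ≡ c
a+[c-a]≡c = solve-∀

[c-a]+a≡c : ∀ a c → (c - a) + a ≡ c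
[c-a]+a≡c = solve-∀

[a+1]-1≡a : ∀ a → a + + 1 - + 1 ≡ a
[a+1]-1≡a = solve-∀

[a-1]+1≡a : ∀ a → a - + 1 + + 1 ≡ a
[a-1]+1≡a = solve-∀

1≰0 : + 1 ≤ + 0 → ⊥
1≰0 (+≤+ ())

0≰-1 : + 0 ≤ - + 1 → ⊥
0≰-1 ()

i≤+∣i∣ : ∀ i → i ≤ + ∣ i ∣
i≤+∣i∣ (+ n) = ≤-refl
i≤+∣i∣ -[1+ n ] = -≤+

m+1≤n⇒m≤n-1 : ∀ {m n} → m + + 1 ≤ n → m ≤ n - + 1
m+1≤n⇒m≤n-1 {m} {n} h = subst (_≤ n - + 1) ([a+1]-1≡a m) (+-monoˡ-≤ (- + 1) h)

m<n⇒m≤n-1 : ∀ {m n} → m < n → m ≤ n - + 1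
m<n⇒m≤n-1 {m} {n} h = subst (m ≤_) (pred≡-1 n) (i<j⇒i≤pred[j] h)
  where pred≡-1 : ∀ n → - + 1 + n ≡ n - + 1
        pred≡-1 = solve-∀

≡-sub⇔sub-≡ : ∀ a {x c} → (x ≡ a - c) ⇔ (a - x ≡ c)
≡-sub⇔sub-≡ a {x} {c} =
  mk⇔ (λ x≡a-c → trans (cong (λ e → a - e) x≡a-c) (a-[a-c]≡c a c))
      (λ a-x≡c → trans (sym (a-[a-c]≡c a x)) (cong (λ e → a - e) a-x≡c))

≡⇔sub-≡0 : ∀ {a x} → (x ≡ a) ⇔ (a - x ≡ + 0)
≡⇔sub-≡0 {a} {x} = mk⇔ (λ x≡a → i≡j⇒i-j≡0 (sym x≡a)) (λ a-x≡0 → sym (i-j≡0⇒i≡j a x a-x≡0))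

≡+⇔sub-≡ : ∀ {a z c} → (a ≡ z + c) ⇔ (a - z ≡ c)
≡+⇔sub-≡ {a} {z} {c} =
  mk⇔ (λ a≡z+c → trans (cong (_- z) a≡z+c) ([a+c]-a≡c z c))
      (λ a-z≡c → trans (sym (a+[c-a]≡c z a)) (cong (λ e → z + e) a-z≡c))

Bit : ℤ → Set
Bit k = k ≡ + 0 ⊎ k ≡ + 1

pattern b₀ = inj₁ refl
pattern b₁ = inj₂ refl

0≤k≤1⇒bit : ∀ {k} → + 0 ≤ k → k ≤ + 1 → Bit k
0≤k≤1⇒bit {+ 0} _ _ = b₀
0≤k≤1⇒bit {+ 1} _ _ = b₁
0≤k≤1⇒bit {+ suc (suc n)} _ (+≤+ (s≤s ()))
0≤k≤1⇒bit { -[1+ n ]} () _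

bit-sub : ∀ {x y} → x ≤ y → y ≤ x + + 1 → Bit (y - x)
bit-sub {x} {y} x≤y y≤x+1 =
  0≤k≤1⇒bit (i≤j⇒0≤j-i x≤y) (subst (y - x ≤_) ([x+1]-x≡1 x) (+-monoˡ-≤ (- x) y≤x+1))
  where [x+1]-x≡1 : ∀ x → x + + 1 - x ≡ + 1
        [x+1]-x≡1 = solve-∀

bit-sub≡1⇔ : ∀ {a b m} → Bit a → Bit b → a - b ≡ m → (m ≡ + 1) ⇔ (a ≡ + 1 × b ≡ + 0)
bit-sub≡1⇔ b₀ b₀ refl = mk⇔ (λ ()) (λ { (() , _) })
bit-sub≡1⇔ b₀ b₁ refl = mk⇔ (λ ()) (λ { (() , _) })
bit-sub≡1⇔ b₁ b₀ refl = mk⇔ (λ _ → refl , refl) (λ _ → refl)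
bit-sub≡1⇔ b₁ b₁ refl = mk⇔ (λ ()) (λ { (_ , ()) })

-- On the unit square below d: u, w are the increments into d along its two edges, v, t the
-- increments out of the opposite corner, s the diagonal increment, and m stands for 𝔪 f d.
bit-square : ∀ {u v w t s m} → Bit u → Bit v → Bit w → Bit t →
  u + v ≡ s → w + t ≡ s → u - t ≡ m →
  (Bit m ⊎ m ≡ - + 1) ×
  (m ≡ + 1 ⇔ (u ≡ + 1 × w ≡ + 1 × s ≡ + 1)) ×
  (m ≡ - + 1 ⇔ (u ≡ + 0 × w ≡ + 0 × s ≡ + 1))
bit-square b₀ b₀ b₀ b₀ refl refl refl =
  inj₁ b₀ , mk⇔ (λ ()) (λ { (() , _) }) , mk⇔ (λ ()) (λ { (_ , _ , ()) })
bit-square b₀ b₁ b₀ b₁ refl refl refl =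
  inj₂ refl , mk⇔ (λ ()) (λ { (() , _) }) , mk⇔ (λ _ → refl , refl , refl) (λ _ → refl)
bit-square b₀ b₁ b₁ b₀ refl refl refl =
  inj₁ b₀ , mk⇔ (λ ()) (λ { (() , _) }) , mk⇔ (λ ()) (λ { (_ , () , _) })
bit-square b₁ b₀ b₀ b₁ refl refl refl =
  inj₁ b₀ , mk⇔ (λ ()) (λ { (_ , () , _) }) , mk⇔ (λ ()) (λ { (() , _) })
bit-square b₁ b₀ b₁ b₀ refl refl refl =
  inj₁ b₁ , mk⇔ (λ _ → refl , refl , refl) (λ _ → refl) , mk⇔ (λ ()) (λ { (() , _) })
bit-square b₁ b₁ b₁ b₁ refl refl refl =
  inj₁ b₀ , mk⇔ (λ ()) (λ { (_ , _ , ()) }) , mk⇔ (λ ()) (λ { (() , _) })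
bit-square b₀ b₀ b₀ b₁ refl () _
bit-square b₀ b₀ b₁ b₀ refl () _
bit-square b₀ b₀ b₁ b₁ refl () _
bit-square b₀ b₁ b₀ b₀ refl () _
bit-square b₀ b₁ b₁ b₁ refl () _
bit-square b₁ b₀ b₀ b₀ refl () _
bit-square b₁ b₀ b₁ b₁ refl () _
bit-square b₁ b₁ b₀ b₀ refl () _
bit-square b₁ b₁ b₀ b₁ refl () _
bit-square b₁ b₁ b₁ b₀ refl () _

module UnitStep (g : ℤ → ℤ) (bit : ∀ j → Bit (g j)) (mono : ∀ j → g (j - + 1) ≤ g j)
                {L U : ℤ} (gL≡0 : g L ≡ + 0) (gU≡1 : g U ≡ + 1) where

  Rise : ℤ → Set
  Rise j = g j ≡ + 1 × g (j - + 1) ≡ + 0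

  mono-+ : ∀ j n → g j ≤ g (j + + n)
  mono-+ j zero = ≤-reflexive (cong g (sym (+-identityʳ j)))
  mono-+ j (suc n) = ≤-trans (mono-+ j n) (subst (λ k → g k ≤ g (j + + suc n)) (step j (+ n)) (mono _))
    where step : ∀ j k → j + (+ 1 + k) - + 1 ≡ j + k
          step = solve-∀

  mono-≤ : ∀ {j k} → j ≤ k → g j ≤ g k
  mono-≤ {j} {k} j≤k = subst (λ m → g j ≤ g m) j+∣k-j∣≡k (mono-+ j ∣ k - j ∣)
    where j+∣k-j∣≡k : j + + ∣ k - j ∣ ≡ k
          j+∣k-j∣≡k = trans (cong (λ e → j + e) (0≤i⇒+∣i∣≡i (i≤j⇒0≤j-i j≤k))) (a+[c-a]≡c j k)

  rise-within : ∀ n x → g x ≡ + 0 → + 1 ≤ g (x + + n) → Σ ℤ Rise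
  rise-within zero x gx≡0 1≤g = ⊥-elim (1≰0 (subst (+ 1 ≤_) (trans (cong g (+-identityʳ x)) gx≡0) 1≤g))
  rise-within (suc n) x gx≡0 1≤g with bit (x + + 1)
  ... | inj₂ g[x+1]≡1 = x + + 1 , g[x+1]≡1 , trans (cong g ([a+1]-1≡a x)) gx≡0
  ... | inj₁ g[x+1]≡0 =
    rise-within n (x + + 1) g[x+1]≡0 (subst (λ k → + 1 ≤ g k) (sym (+-assoc x (+ 1) (+ n))) 1≤g)

  rising-point : Σ ℤ Rise
  rising-point = rise-within ∣ U - L ∣ L gL≡0 (subst (_≤ g (L + + ∣ U - L ∣)) gU≡1 (mono-≤ U≤L+∣U-L∣))
    where U≤L+∣U-L∣ : U ≤ L + + ∣ U - L ∣
          U≤L+∣U-L∣ = subst (_≤ L + + ∣ U - L ∣) (a+[c-a]≡c L U) (+-monoʳ-≤ L (i≤+∣i∣ (U - L)))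

  jump : ℤ
  jump = proj₁ rising-point

  no-later-rise : ∀ {j k} → j < k → Rise j → Rise k → ⊥
  no-later-rise j<k (gj≡1 , _) (_ , g[k-1]≡0) = 1≰0 (subst₂ _≤_ gj≡1 g[k-1]≡0 (mono-≤ (m<n⇒m≤n-1 j<k)))

  rise-unique : ∀ {j k} → Rise j → Rise k → j ≡ k
  rise-unique {j} {k} rj rk with <-cmp j k
  ... | tri< j<k _ _ = ⊥-elim (no-later-rise j<k rj rk)
  ... | tri≈ _ j≡k _ = j≡k
  ... | tri> _ _ k<j = ⊥-elim (no-later-rise k<j rk rj)

  rise⇔≡jump : ∀ {j} → Rise j ⇔ j ≡ jump
  rise⇔≡jump = mk⇔ (λ rj → rise-unique rj (proj₂ rising-point)) (λ { refl → proj₂ rising-point })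

deg-e₁ : ∀ d → deg (d -e₁) ≡ deg d - + 1
deg-e₁ (i , j) = shift i j
  where shift : ∀ i j → i - + 1 + j ≡ i + j - + 1
        shift = solve-∀

deg-e₂ : ∀ d → deg (d -e₂) ≡ deg d - + 1
deg-e₂ (i , j) = shift i j
  where shift : ∀ i j → i + (j - + 1) ≡ i + j - + 1
        shift = solve-∀

-e₁+e₁ : ∀ d → (d -e₁) +e₁ ≡ d
-e₁+e₁ (i , j) = cong (_, j) ([a-1]+1≡a i)

-e₂+e₂ : ∀ d → (d -e₂) +e₂ ≡ d
-e₂+e₂ (i , j) = cong (i ,_) ([a-1]+1≡a j)

module SlowlyGrowingRiemann (f : Pt → ℤ) {A B C : ℤ}
    (vanish : ∀ d → deg d ≤ A → f d ≡ + 0)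
    (linear : ∀ d → B ≤ deg d → f d ≡ deg d + C)
    (slow : SlowlyGrowing f) where

  module Increment (p : Pt → Pt) (deg-p : ∀ d → deg (p d) ≡ deg d - + 1)
                   (slow-p : ∀ d → f (p d) ≤ f d × f d ≤ f (p d) + + 1) where

    Δ : Pt → ℤ
    Δ d = f d - f (p d)

    Δ-bit : ∀ d → Bit (Δ d)
    Δ-bit d = bit-sub (proj₁ (slow-p d)) (proj₂ (slow-p d))

    deg-p≤deg : ∀ d → deg (p d) ≤ deg d
    deg-p≤deg d = subst (_≤ deg d) (sym (deg-p d)) (i-j≤i (deg d) (+ 1))

    Δ-low : ∀ d → deg d ≤ A → Δ d ≡ + 0
    Δ-low d h = cong₂ _-_ (vanish d h) (vanish (p d) (≤-trans (deg-p≤deg d) h))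

    Δ-high : ∀ d → B + + 1 ≤ deg d → Δ d ≡ + 1
    Δ-high d h = begin
      f d - f (p d)                   ≡⟨ cong₂ _-_ (linear d B≤deg) (linear (p d) B≤deg-p) ⟩
      (deg d + C) - (deg (p d) + C)   ≡⟨ cong (λ e → (deg d + C) - (e + C)) (deg-p d) ⟩
      (deg d + C) - (deg d - + 1 + C) ≡⟨ cancel (deg d) C ⟩
      + 1                             ∎
      where
      open ≡-Reasoning
      B≤deg-p : B ≤ deg (p d)
      B≤deg-p = subst (B ≤_) (sym (deg-p d)) (m+1≤n⇒m≤n-1 h)
      B≤deg : B ≤ deg d
      B≤deg = ≤-trans B≤deg-p (deg-p≤deg d)
      cancel : ∀ k c → (k + c) - (k - + 1 + c) ≡ + 1
      cancel = solve-∀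

  slow-e₁ : ∀ d → f (d -e₁) ≤ f d × f d ≤ f (d -e₁) + + 1
  slow-e₁ d = subst (λ e → f (d -e₁) ≤ f e × f e ≤ f (d -e₁) + + 1) (-e₁+e₁ d) (proj₁ (slow (d -e₁)))

  slow-e₂ : ∀ d → f (d -e₂) ≤ f d × f d ≤ f (d -e₂) + + 1
  slow-e₂ d = subst (λ e → f (d -e₂) ≤ f e × f e ≤ f (d -e₂) + + 1) (-e₂+e₂ d) (proj₂ (slow (d -e₂)))

  open Increment _-e₁ deg-e₁ slow-e₁
    renaming (Δ to Δ₁; Δ-bit to Δ₁-bit; Δ-low to Δ₁-low; Δ-high to Δ₁-high) using ()
  open Increment _-e₂ deg-e₂ slow-e₂
    renaming (Δ to Δ₂; Δ-bit to Δ₂-bit; deg-p≤deg to deg-e₂≤deg; Δ-low to Δ₂-low; Δ-high to Δ₂-high) using ()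

  𝔪-via-Δ₁ : ∀ d → 𝔪 f d ≡ Δ₁ d - Δ₁ (d -e₂)
  𝔪-via-Δ₁ d = split (f d) (f (d -e₁)) (f (d -e₂)) (f ((d -e₁) -e₂))
    where split : ∀ a x y z → a - x - y + z ≡ (a - x) - (y - z)
          split = solve-∀

  𝔪-via-Δ₂ : ∀ d → 𝔪 f d ≡ Δ₂ d - Δ₂ (d -e₁)
  𝔪-via-Δ₂ d = split (f d) (f (d -e₁)) (f (d -e₂)) (f ((d -e₁) -e₂))
    where split : ∀ a x y z → a - x - y + z ≡ (a - y) - (x - z)
          split = solve-∀

  𝔪-square : ∀ d →
    (Bit (𝔪 f d) ⊎ 𝔪 f d ≡ - + 1) ×
    (𝔪 f d ≡ + 1 ⇔ (Δ₁ d ≡ + 1 × Δ₂ d ≡ + 1 × f d - f ((d -e₁) -e₂) ≡ + 1)) ×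
    (𝔪 f d ≡ - + 1 ⇔ (Δ₁ d ≡ + 0 × Δ₂ d ≡ + 0 × f d - f ((d -e₁) -e₂) ≡ + 1))
  𝔪-square d = bit-square (Δ₁-bit d) (Δ₂-bit (d -e₁)) (Δ₂-bit d) (Δ₁-bit (d -e₂))
    (+-minus-telescope (f d) (f (d -e₁)) (f ((d -e₁) -e₂)))
    (+-minus-telescope (f d) (f (d -e₂)) (f ((d -e₁) -e₂)))
    (sym (𝔪-via-Δ₁ d))

  𝔪-values : ∀ d → Bit (𝔪 f d) ⊎ 𝔪 f d ≡ - + 1
  𝔪-values d = proj₁ (𝔪-square d)

  𝔪≡1⇔ : ∀ d → 𝔪 f d ≡ + 1 ⇔
    (f (d -e₁) ≡ f d - + 1 × f (d -e₂) ≡ f d - + 1 × f ((d -e₁) -e₂) ≡ f d - + 1)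
  𝔪≡1⇔ d = ⇔-trans (proj₁ (proj₂ (𝔪-square d)))
    (⇔-sym (≡-sub⇔sub-≡ (f d) ×-⇔ ≡-sub⇔sub-≡ (f d) ×-⇔ ≡-sub⇔sub-≡ (f d)))

  𝔪≡-1⇔ : ∀ d → 𝔪 f d ≡ - + 1 ⇔
    (f (d -e₁) ≡ f d × f (d -e₂) ≡ f d × f d ≡ f ((d -e₁) -e₂) + + 1)
  𝔪≡-1⇔ d = ⇔-trans (proj₂ (proj₂ (𝔪-square d))) (⇔-sym (≡⇔sub-≡0 ×-⇔ ≡⇔sub-≡0 ×-⇔ ≡+⇔sub-≡))

  𝔪-initially-eventually-zero : InitiallyEventuallyZero (𝔪 f)
  𝔪-initially-eventually-zero = A , B + + 1 + + 1 , low , high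
    where
    low : ∀ d → deg d ≤ A → 𝔪 f d ≡ + 0
    low d h = trans (𝔪-via-Δ₁ d) (cong₂ _-_ (Δ₁-low d h) (Δ₁-low (d -e₂) (≤-trans (deg-e₂≤deg d) h)))

    high : ∀ d → B + + 1 + + 1 ≤ deg d → 𝔪 f d ≡ + 0
    high d h = trans (𝔪-via-Δ₁ d) (cong₂ _-_ (Δ₁-high d (≤-trans h′ (deg-e₂≤deg d))) (Δ₁-high (d -e₂) h′))
      where h′ : B + + 1 ≤ deg (d -e₂)
            h′ = subst (B + + 1 ≤_) (sym (deg-e₂ d)) (m+1≤n⇒m≤n-1 h)

  module Nonnegative (nonneg : ∀ d → + 0 ≤ 𝔪 f d) where

    𝔪-bit : ∀ d → Bit (𝔪 f d)
    𝔪-bit d with 𝔪-values d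
    ... | inj₁ bit = bit
    ... | inj₂ 𝔪≡-1 = ⊥-elim (0≰-1 (subst (+ 0 ≤_) 𝔪≡-1 (nonneg d)))

    module Row (i : ℤ) = UnitStep (λ j → Δ₁ (i , j)) (λ j → Δ₁-bit (i , j))
      (λ j → 0≤i-j⇒j≤i (subst (+ 0 ≤_) (𝔪-via-Δ₁ (i , j)) (nonneg (i , j))))
      (Δ₁-low (i , A - i) (≤-reflexive (a+[c-a]≡c i A)))
      (Δ₁-high (i , B + + 1 - i) (≤-reflexive (sym (a+[c-a]≡c i (B + + 1)))))

    module Column (j : ℤ) = UnitStep (λ i → Δ₂ (i , j)) (λ i → Δ₂-bit (i , j))
      (λ i → 0≤i-j⇒j≤i (subst (+ 0 ≤_) (𝔪-via-Δ₂ (i , j)) (nonneg (i , j))))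
      (Δ₂-low (A - j , j) (≤-reflexive ([c-a]+a≡c j A)))
      (Δ₂-high (B + + 1 - j , j) (≤-reflexive (sym ([c-a]+a≡c j (B + + 1)))))

    π τ : ℤ → ℤ
    π = Row.jump
    τ = Column.jump

    𝔪≡1⇔≡π : ∀ i j → 𝔪 f (i , j) ≡ + 1 ⇔ j ≡ π i
    𝔪≡1⇔≡π i j =
      ⇔-trans (bit-sub≡1⇔ (Δ₁-bit _) (Δ₁-bit _) (sym (𝔪-via-Δ₁ (i , j)))) (Row.rise⇔≡jump i)

    𝔪≡1⇔≡τ : ∀ i j → 𝔪 f (i , j) ≡ + 1 ⇔ i ≡ τ j
    𝔪≡1⇔≡τ i j =
      ⇔-trans (bit-sub≡1⇔ (Δ₂-bit _) (Δ₂-bit _) (sym (𝔪-via-Δ₂ (i , j)))) (Column.rise⇔≡jump j)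

    π-bijective : Bijective _≡_ _≡_ π
    π-bijective = inverseᵇ⇒bijective {f = π} {f⁻¹ = τ} (π∘τ , τ∘π)
      where
      π∘τ : Inverseˡ _≡_ _≡_ π τ
      π∘τ {j} {i} i≡τj = sym (to (𝔪≡1⇔≡π i j) (from (𝔪≡1⇔≡τ i j) i≡τj))
      τ∘π : Inverseʳ _≡_ _≡_ π τ
      τ∘π {i} {j} j≡πi = sym (to (𝔪≡1⇔≡τ i j) (from (𝔪≡1⇔≡π i j) j≡πi))

    𝔪≡0-off-π : ∀ {i j} → j ≢ π i → 𝔪 f (i , j) ≡ + 0
    𝔪≡0-off-π {i} {j} j≢πi with 𝔪-bit (i , j)
    ... | inj₁ 𝔪≡0 = 𝔪≡0
    ... | inj₂ 𝔪≡1 = ⊥-elim (j≢πi (to (𝔪≡1⇔≡π i j) 𝔪≡1))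

    𝔪-perfect-matching : IsPerfectMatching (𝔪 f)
    𝔪-perfect-matching =
      𝔪-initially-eventually-zero , π , π-bijective , λ i j → from (𝔪≡1⇔≡π i j) , 𝔪≡0-off-π

proposition5p3 : (f : Pt → ℤ) → IsRiemann f → SlowlyGrowing f →
    ((d : Pt) → (𝔪 f d ≡ + 0 ⊎ 𝔪 f d ≡ + 1) ⊎ 𝔪 f d ≡ - + 1) ×
    ((d : Pt) →
      (𝔪 f d ≡ + 1 ⇔
        (f (d -e₁) ≡ f d - + 1 × f (d -e₂) ≡ f d - + 1 × f ((d -e₁) -e₂) ≡ f d - + 1)) ×
      (𝔪 f d ≡ - + 1 ⇔
        (f (d -e₁) ≡ f d × f (d -e₂) ≡ f d × f d ≡ f ((d -e₁) -e₂) + + 1))) ×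
    (((d : Pt) → + 0 ≤ 𝔪 f d) → IsPerfectMatching (𝔪 f))
proposition5p3 f (_ , _ , _ , vanish , linear) slow =
  𝔪-values , (λ d → 𝔪≡1⇔ d , 𝔪≡-1⇔ d) , Nonnegative.𝔪-perfect-matching
  where open SlowlyGrowingRiemann f vanish linear slow
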